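{- Let $n\ge3$ and let $c=(c_1,\dots,c_n)$ be a configuration on the wheel graph $W^0_n$. Then $c$ is strongly recurrent if and only if $c\in\{1,2\}^n$ and $|\{i\in[n]:c_i=1\}|\le1$. In particular, $|\mathrm{SR}(W^0_n)|=|\mathrm{PPF}(W^0_n)|=n+1$.
   Context: The wheel graph $W^0_n$ consists of a cycle on vertices $1,\dots,n$ together with a central vertex $0$ joined by a single edge to each cycle vertex; the sink is $0$. A configuration is $c:[n]\to\mathbb Z$, written $c_i=c(i)$. General definitions for a graph $G$ (finite connected multigraph, no loops) with vertex set $V$, sink $s$, $\tilde V=V\setminus\{s\}$: $\mathrm{mult}(vw)$ is the number of edges between $v,w$; $\deg^A(v)=\sum_{w\in A}\mathrm{mult}(vw)$, $\deg(v)=\deg^V(v)$; $\mathbb 1_v$ the indicator of $v$; $\mathbb N=\{1,2,\dots\}$. $c$ is stable if $c(v)<\deg(v)$ for all $v$. A stable $c$ is recurrent if it is a recurrent state of the Abelian sandpile Markov chain (add a grain at a random non-sink vertex, then stabilise by topplings $c\mapsto c-\deg(v)\mathbb 1_v+\sum_{w\in\tilde V}\mathrm{mult}(vw)\mathbb 1_w$ at unstable $v$); equivalently there is an ordering $v_1,\dots$ of $\tilde V$ with $c(v_i)\ge\deg^{V\setminus\{s,v_1,\dots,v_{i-1}\}}(v_i)$ for all $i$. For recurrent $c$, $V_M(c)=\{v\in\tilde V:\mathrm{mult}(vs)\ge1,\ c(v)\ge\deg(v)-\mathrm{mult}(vs)\}$ and $c^{v- }=c-\sum_{w\in\tilde V\setminus\{v\}}\mathrm{mult}(ws)\mathbb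 1_w$; $c$ is strongly recurrent if $c^{v- }$ is recurrent for all $v\in V_M(c)$; $\mathrm{SR}(G)$ is their set. A $G$-parking function is $p:\tilde V\to\mathbb N$ such that every non-empty $S\subseteq\tilde V$ contains $v$ with $p(v)\le\deg^{V\setminus S}(v)$. For $A\subseteq\tilde V$, $G^A$ is the induced subgraph on $A\cup\{s\}$ with sink $s$ (parking functions defined likewise). $p$ is decomposable w.r.t. an ordered partition $(A,B)$ of $\tilde V$ ($A,B\ne\emptyset$) if $p|_A$ is a $G^A$-parking function and $v\mapsto p(v)-\deg^A(v)$ on $B$ is a $G^B$-parking function; $p$ is prime if decomposable w.r.t. no such partition; $\mathrm{PPF}(G)$ is the set of prime $G$-parking functions. -}

module Defs where

open import Data.Nat as ℕ using (ℕ; zero; suc)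
open import Data.Nat.ListAction using (sum)
open import Data.Integer as ℤ using (ℤ; +_; _-_; _≤_; _<_)
open import Data.Bool using (Bool; true; false; _∨_; _∧_; if_then_else_)
open import Data.Fin using (Fin; toℕ; _≟_)
open import Data.Fin.Subset as Sub using (Subset; _∈_; _⊆_; Nonempty; ∁; _∪_; _─_; ⁅_⁆)
open import Data.Vec as Vec using (Vec; lookup; tabulate)
open import Data.List as List using (List; []; _∷_; length; allFin)
open import Data.List.Relation.Binary.Permutation.Propositional using (_↭_)
open import Data.List.Relation.Unary.Unique.Propositional using (Unique)
import Data.List.Membership.Propositional as LMem
open import Data.Product using (Σ; ∃; _×_)
open import Data.Unit using (⊤)
open import Relation.Nullary using (¬_; does)
open import Function.Bundles using (_⇔_)

-- The non-sink vertices are  Fin k ; the sink is kept separate.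
--   multV v w : number of edges between non-sink vertices v and w
--   multS v   : number of edges between non-sink vertex v and the sink

record SinkGraph (k : ℕ) : Set where
  field
    multV : Fin k → Fin k → ℕ
    multS : Fin k → ℕ

open SinkGraph public

sumFin : ∀ {k} → (Fin k → ℕ) → ℕ
sumFin f = sum (List.map f (allFin _))

degIn : ∀ {k} → SinkGraph k → Subset k → Fin k → ℕ
degIn G A v = sumFin (λ w → if lookup A w then multV G v w else 0)

degInS : ∀ {k} → SinkGraph k → Subset k → Fin k → ℕ
degInS G A v = multS G v ℕ.+ degIn G A v

deg : ∀ {k} → SinkGraph k → Fin k → ℕ
deg G v = degInS G Sub.⊤ v

Config : ℕ → Set
Config k = Vec ℤ k

Stable : ∀ {k} → SinkGraph k → Config k → Set
Stable G c = ∀ v → lookup c v < + deg G v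

BurnOK : ∀ {k} → SinkGraph k → Config k → Subset k → List (Fin k) → Set
BurnOK G c burnt []       = ⊤
BurnOK G c burnt (v ∷ vs) =
  (+ degIn G (∁ burnt) v ≤ lookup c v) × BurnOK G c (burnt ∪ ⁅ v ⁆) vs

Recurrent : ∀ {k} → SinkGraph k → Config k → Set
Recurrent G c = Stable G c × Σ (List (Fin _)) (λ vs → (vs ↭ allFin _) × BurnOK G c Sub.⊥ vs)

InVM : ∀ {k} → SinkGraph k → Config k → Fin k → Set
InVM G c v = (1 ℕ.≤ multS G v) × (+ deg G v - + multS G v ≤ lookup c v)

cMinus : ∀ {k} → SinkGraph k → Config k → Fin k → Config k
cMinus G c v = tabulate (λ w → if does (w ≟ v) then lookup c w else lookup c w - + multS G w)

StronglyRecurrent : ∀ {k} → SinkGraph k → Config k → Set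
StronglyRecurrent G c = Recurrent G c × (∀ v → InVM G c v → Recurrent G (cMinus G c v))

-- IsPFOn G A p : the restriction of p to A is a G^A-parking function, where
-- G^A is the induced subgraph on A ∪ {s} with sink s: p(v) ≥ 1 on A, and every
-- non-empty S ⊆ A contains v with p(v) ≤ deg^{(A ∪ {s}) ∖ S}(v).

IsPFOn : ∀ {k} → SinkGraph k → Subset k → (Fin k → ℤ) → Set
IsPFOn G A p =
  (∀ v → v ∈ A → + 1 ≤ p v) ×
  (∀ S → S ⊆ A → Nonempty S → ∃ λ v → v ∈ S × p v ≤ + degInS G (A ─ S) v)

-- G-parking functions p : Ṽ → ℕ = {1,2,…} (positivity is part of IsPFOn)
ParkingFunction : ∀ {k} → SinkGraph k → Vec ℕ k → Set
ParkingFunction G p = IsPFOn G Sub.⊤ (λ v → + lookup p v)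

DecomposableWrt : ∀ {k} → SinkGraph k → Vec ℕ k → Subset k → Set
DecomposableWrt G p A =
  Nonempty A × Nonempty (∁ A) ×
  IsPFOn G A (λ v → + lookup p v) ×
  IsPFOn G (∁ A) (λ v → + lookup p v - + degIn G A v)

PrimeParkingFunction : ∀ {k} → SinkGraph k → Vec ℕ k → Set
PrimeParkingFunction G p = ParkingFunction G p × ¬ (∃ λ A → DecomposableWrt G p A)

HasCardinality : ∀ {A : Set} → (A → Set) → ℕ → Set
HasCardinality {A} P m =
  Σ (List A) λ L → Unique L × length L ≡ m × (∀ x → P x ⇔ x LMem.∈ L)
  where open import Relation.Binary.PropositionalEquality using (_≡_)

-- The wheel W⁰ₙ: sink 0, cycle vertices 1,…,n represented by Fin n
-- (Fin element i stands for vertex i+1).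

cycAdj : ℕ → ℕ → ℕ → Bool
cycAdj n a b =
  (suc a ℕ.≡ᵇ b) ∨ (suc b ℕ.≡ᵇ a) ∨
  ((a ℕ.≡ᵇ 0) ∧ (suc b ℕ.≡ᵇ n)) ∨ ((b ℕ.≡ᵇ 0) ∧ (suc a ℕ.≡ᵇ n))

Wheel : (n : ℕ) → SinkGraph n
Wheel n = record
  { multV = λ i j → if cycAdj n (toℕ i) (toℕ j) then 1 else 0
  ; multS = λ _ → 1
  }

-- On the wheel every cycle vertex has degree 3, so stable means all values are at most 2.
-- If c is strongly recurrent, recurrence (every nonempty S contains a w with c w ≥ deg^S w)
-- applied to the whole cycle yields a v with c v = 2; then c^{v-} is recurrent, which forces
-- c ≥ 1, and two vertices with value 1 would be zeros of c^{v-} bounding an arc on which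
-- c^{v-} ≤ 1 away from v, a set no vertex of which can burn.  Conversely c and all c^{v-} are
-- recurrent: burn v, then the cycle with the vertex of value 1 removed outwards from v, and
-- that vertex last.  A parking function with a value ≥ 3 or two values ≥ 2 decomposes by
-- splitting off the maximal run of ones that follows a vertex of value ≠ 1; when only one
-- vertex u has value 2, any part A of a decomposition would be entered and left through u,
-- so both neighbours of u would lie in A.  Either set is thus in bijection with the n + 1
-- vectors over {a, b} with at most one a.

module Submission where

open import Defs
open import Data.Nat using (ℕ; suc; _≤_)
open import Data.Integer using (ℤ; +_)
open import Data.Vec using (Vec; count)
open import Data.Vec.Relation.Unary.All using (All)
open import Data.Sum using (_⊎_)
open import Data.Product using (_×_)
open import Relation.Binary.PropositionalEquality using (_≡_)
open import Function.Bundles using (_⇔_)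
import Data.Integer.Properties as ℤP

open import Algebra.Properties.CommutativeSemigroup using (interchange)
open import Data.Bool using (true; false; if_then_else_; not; T; _∨_; _∧_)
import Data.Bool.Properties as BoolP
open import Data.Empty using (⊥; ⊥-elim)
open import Data.Fin as F using (Fin; toℕ)
import Data.Fin.Properties as FP
open import Data.Fin.Subset as Sub using (Subset; _∈_; _∉_; _⊆_; _∪_; _─_; ∁; ⁅_⁆; Nonempty)
import Data.Fin.Subset.Properties as SubP
import Data.Integer as ℤ
open import Data.List as List using (List; []; _∷_; allFin)
import Data.List.Properties as ListP
import Data.List.Membership.Propositional as ListMem
open import Data.List.Membership.Propositional.Properties using (∈-allFin; ∈-map⁺; ∈-map⁻)
open import Data.List.Relation.Binary.Permutation.Propositional using (↭-sym)
open import Data.List.Relation.Binary.Permutation.Propositional.Properties using (∈-resp-↭)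
import Data.List.Relation.Unary.All as ListAll
open import Data.List.Relation.Unary.AllPairs using (AllPairs; []; _∷_)
open import Data.List.Relation.Unary.Any using (here; there)
open import Data.List.Relation.Unary.Sorted.TotalOrder.Properties using (Sorted⇒AllPairs)
open import Data.List.Relation.Unary.Unique.Propositional using (Unique)
import Data.List.Relation.Unary.Unique.Propositional.Properties as UniqueP
open import Data.Nat as ℕ using (zero; _+_; _∸_; _<_; z≤n; s≤s; ∣_-_∣)
open import Data.Nat.GeneralisedArithmetic using (iterate)
open import Data.Nat.ListAction using (sum)
open import Data.Nat.Properties
open import Data.Product using (∃; _,_; proj₁; proj₂)
open import Data.Sum as Sum using (inj₁; inj₂; [_,_]′)
open import Data.Unit using (tt)
open import Data.Vec as Vec using ([]; _∷_; lookup)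
import Data.Vec.Properties as VecP
open import Data.Vec.Relation.Unary.All using ([]; _∷_)
import Data.Vec.Relation.Unary.All.Properties as VecAllP
open import Function using (_∘_; case_of_)
open import Function.Bundles using (mk⇔; Equivalence)
open import Function.Construct.Composition using (_⇔-∘_)
open import Relation.Binary.Bundles using (DecTotalOrder)
import Relation.Binary.Construct.On as On
open import Relation.Binary.Definitions using (DecidableEquality; Tri; tri<; tri≈; tri>)
open import Relation.Binary.PropositionalEquality
  using (refl; sym; trans; cong; cong₂; subst; subst₂; _≢_; module ≡-Reasoning)
open import Relation.Nullary using (¬_; ¬?; Dec; yes; no; does; _×-dec_; _→-dec_)
open import Relation.Nullary.Decidable using (dec-true; dec-false; decidable-stable)

-- Sums over Fin

sum-tabulate-0 : ∀ k → sum (List.tabulate {n = k} (λ _ → 0)) ≡ 0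
sum-tabulate-0 zero    = refl
sum-tabulate-0 (suc k) = sum-tabulate-0 k

module _ {k : ℕ} where

  sumFin-tabulate : (f : Fin k → ℕ) → sumFin f ≡ sum (List.tabulate f)
  sumFin-tabulate f = cong sum (ListP.map-tabulate (λ w → w) f)

  sumFin-cong : {f g : Fin k → ℕ} → (∀ w → f w ≡ g w) → sumFin f ≡ sumFin g
  sumFin-cong f≗g = cong sum (ListP.map-cong f≗g (allFin k))

  sumFin-mono : {f g : Fin k → ℕ} → (∀ w → f w ≤ g w) → sumFin f ≤ sumFin g
  sumFin-mono {f} {g} f≤g = go (allFin k)
    where
    go : ∀ ws → sum (List.map f ws) ≤ sum (List.map g ws)
    go []       = z≤n
    go (w ∷ ws) = +-mono-≤ (f≤g w) (go ws)

  sumFin-+ : (f g : Fin k → ℕ) → sumFin (λ w → f w + g w) ≡ sumFin f + sumFin g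
  sumFin-+ f g = go (allFin k)
    where
    go : ∀ ws → sum (List.map (λ w → f w + g w) ws) ≡ sum (List.map f ws) + sum (List.map g ws)
    go []       = refl
    go (w ∷ ws) = trans (cong (_+_ (f w + g w)) (go ws))
                        (interchange +-commutativeSemigroup (f w) (g w) _ _)

sumFin-0 : ∀ k → sumFin {k} (λ _ → 0) ≡ 0
sumFin-0 k = trans (sumFin-tabulate {k} (λ _ → 0)) (sum-tabulate-0 k)

sumFin-point : ∀ {k} (a : Fin k) (f : Fin k → ℕ) →
  sumFin (λ w → if does (a F.≟ w) then f w else 0) ≡ f a
sumFin-point a f = trans (sumFin-tabulate (λ w → if does (a F.≟ w) then f w else 0)) (go a f)
  where
  go : ∀ {k} (a : Fin k) (f : Fin k → ℕ) →
    sum (List.tabulate (λ w → if does (a F.≟ w) then f w else 0)) ≡ f a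
  go {suc k} F.zero    f = trans (cong (_+_ (f F.zero)) (sum-tabulate-0 k)) (+-identityʳ _)
  go {suc k} (F.suc a) f = go a (f ∘ F.suc)

-- Burning, recurrence and decompositions on an arbitrary sink graph

module _ {k : ℕ} {P : Fin k → Set} where

  subsetOf : ((w : Fin k) → Dec (P w)) → Subset k
  subsetOf P? = Vec.tabulate (does ∘ P?)

  ∈-subsetOf⁺ : (P? : (w : Fin k) → Dec (P w)) → ∀ {w} → P w → w ∈ subsetOf P?
  ∈-subsetOf⁺ P? {w} pw =
    VecP.lookup⇒[]= w (subsetOf P?) (trans (VecP.lookup∘tabulate _ w) (dec-true (P? w) pw))

  ∈-subsetOf⁻ : (P? : (w : Fin k) → Dec (P w)) → ∀ {w} → w ∈ subsetOf P? → P w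
  ∈-subsetOf⁻ P? {w} w∈ = does⇒P (trans (sym (VecP.lookup∘tabulate _ w)) (VecP.[]=⇒lookup w∈))
    where
    does⇒P : does (P? w) ≡ true → P w
    does⇒P eq with P? w
    ... | yes pw = pw

∉⇒lookup≡false : ∀ {k} {X : Subset k} {w} → w ∉ X → lookup X w ≡ false
∉⇒lookup≡false {X = X} {w} w∉X with lookup X w in eq
... | true  = ⊥-elim (w∉X (VecP.lookup⇒[]= w X eq))
... | false = refl

lookup-─ : ∀ {k} (X Y : Subset k) w → lookup (X ─ Y) w ≡ (if lookup Y w then false else lookup X w)
lookup-─ (x ∷ X) (true  ∷ Y) F.zero    = refl
lookup-─ (x ∷ X) (false ∷ Y) F.zero    = refl
lookup-─ (x ∷ X) (y ∷ Y)     (F.suc w) = lookup-─ X Y w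

+m-+n≡+[m∸n] : ∀ {m n} → n ≤ m → + m ℤ.- + n ≡ + (m ∸ n)
+m-+n≡+[m∸n] {m} {n} n≤m = trans (ℤP.m-n≡m⊖n m n) (ℤP.⊖-≥ n≤m)

module _ {k : ℕ} (G : SinkGraph k) where

  degIn-mono : ∀ {X Y} → X ⊆ Y → ∀ v → degIn G X v ≤ degIn G Y v
  degIn-mono {X} {Y} X⊆Y v = sumFin-mono pointwise
    where
    pointwise : ∀ w → (if lookup X w then multV G v w else 0) ≤ (if lookup Y w then multV G v w else 0)
    pointwise w with lookup X w in eq
    ... | false = z≤n
    ... | true rewrite VecP.[]=⇒lookup (X⊆Y (VecP.lookup⇒[]= w X eq)) = ≤-refl

  degIn-⊥ : ∀ v → degIn G Sub.⊥ v ≡ 0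
  degIn-⊥ v = trans (sumFin-cong {g = λ _ → 0} (λ w → cong (if_then multV G v w else 0) (VecP.lookup-replicate w false)))
                    (sumFin-0 k)

  degIn-⊤─-split : ∀ A S → S ⊆ ∁ A → ∀ v →
    degIn G (Sub.⊤ ─ S) v ≡ degIn G (∁ A ─ S) v + degIn G A v
  degIn-⊤─-split A S S⊆∁A v = trans (sumFin-cong pointwise) (sumFin-+ {k} _ _)
    where
    pointwise : ∀ w → (if lookup (Sub.⊤ ─ S) w then multV G v w else 0)
                    ≡ (if lookup (∁ A ─ S) w then multV G v w else 0) + (if lookup A w then multV G v w else 0)
    pointwise w
      rewrite lookup-─ Sub.⊤ S w | lookup-─ (∁ A) S w
            | VecP.lookup-map w not A | VecP.lookup-replicate w true
      with lookup S w in eS | lookup A w in eA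
    ... | false | false = sym (+-identityʳ _)
    ... | false | true  = refl
    ... | true  | false = refl
    ... | true  | true  = ⊥-elim (SubP.x∈∁p⇒x∉p (S⊆∁A (VecP.lookup⇒[]= w S eS)) (VecP.lookup⇒[]= w A eA))

  burnOK⇒burnable : ∀ {c burnt vs S x} → BurnOK G c burnt vs → (∀ {w} → w ∈ S → w ∉ burnt) →
    x ∈ S → x ListMem.∈ vs → ∃ λ w → w ∈ S × + degIn G S w ℤ.≤ lookup c w
  burnOK⇒burnable {vs = v ∷ vs} {S} {x} (v-ok , vs-ok) S∩burnt≡∅ x∈S x∈vs with v SubP.∈? S
  ... | yes v∈S = v , v∈S , ℤP.≤-trans (ℤ.+≤+ (degIn-mono S⊆∁burnt v)) v-ok
    where
    S⊆∁burnt : S ⊆ ∁ _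
    S⊆∁burnt w∈S = SubP.x∉p⇒x∈∁p (S∩burnt≡∅ w∈S)
  ... | no v∉S = burnOK⇒burnable vs-ok S∩burnt∪v≡∅ x∈S (x∈tail x∈vs)
    where
    S∩burnt∪v≡∅ : ∀ {w} → w ∈ S → w ∉ _ ∪ ⁅ v ⁆
    S∩burnt∪v≡∅ {w} w∈S w∈ =
      [ S∩burnt≡∅ w∈S , (λ w∈v → v∉S (subst (_∈ S) (SubP.x∈⁅y⁆⇒x≡y v w∈v) w∈S)) ]′ (SubP.x∈p∪q⁻ _ ⁅ v ⁆ w∈)
    x∈tail : x ListMem.∈ v ∷ vs → x ListMem.∈ vs
    x∈tail (here refl)  = ⊥-elim (v∉S x∈S)
    x∈tail (there x∈vs) = x∈vs

  recurrent⇒burnable : ∀ {c S} → Recurrent G c → Nonempty S →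
    ∃ λ w → w ∈ S × + degIn G S w ℤ.≤ lookup c w
  recurrent⇒burnable (_ , vs , vs↭ , ok) (x , x∈S) =
    burnOK⇒burnable ok (λ _ → SubP.∉⊥) x∈S (∈-resp-↭ (↭-sym vs↭) (∈-allFin x))

  module _ (rank : Fin k → ℕ) where

    rankAtLeast : Fin k → Subset k
    rankAtLeast v = subsetOf (λ u → rank v ℕ.≤? rank u)

    private
      rankOrder : DecTotalOrder _ _ _
      rankOrder = On.decTotalOrder ≤-decTotalOrder rank

      open import Data.List.Sort rankOrder using (sort; sort-↭; sort-↗)

      burnInOrder : ∀ {c burnt} vs → (∀ v → + degIn G (rankAtLeast v) v ℤ.≤ lookup c v) →
        AllPairs (λ u w → rank u ℕ.≤ rank w) vs → (∀ {x} → x ∉ burnt → x ListMem.∈ vs) →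
        BurnOK G c burnt vs
      burnInOrder []       bound sorted        unburnt⊆vs = tt
      burnInOrder {burnt = burnt} (v ∷ vs) bound (v≤vs ∷ sorted) unburnt⊆vs =
        ℤP.≤-trans (ℤ.+≤+ (degIn-mono ∁burnt⊆rankAtLeast v)) (bound v) ,
        burnInOrder vs bound sorted unburnt⊆vs′
        where
        ∁burnt⊆rankAtLeast : ∁ burnt ⊆ rankAtLeast v
        ∁burnt⊆rankAtLeast x∈ with unburnt⊆vs (SubP.x∈∁p⇒x∉p x∈)
        ... | here refl  = ∈-subsetOf⁺ (λ u → rank v ℕ.≤? rank u) ≤-refl
        ... | there x∈vs = ∈-subsetOf⁺ (λ u → rank v ℕ.≤? rank u) (ListAll.lookup v≤vs x∈vs)
        unburnt⊆vs′ : ∀ {x} → x ∉ burnt ∪ ⁅ v ⁆ → x ListMem.∈ vs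
        unburnt⊆vs′ x∉ with unburnt⊆vs (x∉ ∘ SubP.p⊆p∪q ⁅ v ⁆)
        ... | here refl  = ⊥-elim (x∉ (SubP.q⊆p∪q burnt ⁅ v ⁆ (SubP.x∈⁅x⁆ v)))
        ... | there x∈vs = x∈vs

    recurrent-byRank : ∀ {c} → Stable G c → (∀ v → + degIn G (rankAtLeast v) v ℤ.≤ lookup c v) →
      Recurrent G c
    recurrent-byRank stable bound =
      stable , sort (allFin k) , sort-↭ (allFin k) ,
      burnInOrder (sort (allFin k)) bound (Sorted⇒AllPairs (DecTotalOrder.totalOrder rankOrder) (sort-↗ (allFin k)))
        (λ {x} _ → ∈-resp-↭ (↭-sym (sort-↭ (allFin k))) (∈-allFin x))

  recurrent⇒nonnegative : ∀ {c} → Recurrent G c → ∀ v → + 0 ℤ.≤ lookup c v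
  recurrent⇒nonnegative rec v with recurrent⇒burnable rec (v , SubP.x∈⁅x⁆ v)
  ... | w , w∈⁅v⁆ , deg≤c rewrite SubP.x∈⁅y⁆⇒x≡y v w∈⁅v⁆ = ℤP.≤-trans (ℤ.+≤+ z≤n) deg≤c

  lookup-cMinus : ∀ c v w → lookup (cMinus G c v) w ≡ (if does (w F.≟ v) then lookup c w else lookup c w ℤ.- + multS G w)
  lookup-cMinus c v = VecP.lookup∘tabulate (λ w → if does (w F.≟ v) then lookup c w else lookup c w ℤ.- + multS G w)

  cMinus-self : ∀ c v → lookup (cMinus G c v) v ≡ lookup c v
  cMinus-self c v rewrite lookup-cMinus c v v | dec-true (v F.≟ v) refl = refl

  cMinus-other : ∀ c {v w} → w ≢ v → lookup (cMinus G c v) w ≡ lookup c w ℤ.- + multS G w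
  cMinus-other c {v} {w} w≢v rewrite lookup-cMinus c v w | dec-false (w F.≟ v) w≢v = refl

  parkingFunction-positive : ∀ {p} → ParkingFunction G p → ∀ v → 1 ≤ lookup p v
  parkingFunction-positive (positive , _) v = ℤP.drop‿+≤+ (positive v SubP.∈⊤)

  parkingFunction-∃≤multS : ∀ {p} → ParkingFunction G p → Fin k → ∃ λ v → lookup p v ≤ multS G v
  parkingFunction-∃≤multS {p} (_ , parks) x with parks Sub.⊤ (λ w∈ → w∈) (x , SubP.∈⊤)
  ... | v , _ , p≤ = v , subst (lookup p v ≤_) multS+0 (ℤP.drop‿+≤+ p≤)
    where
    multS+0 : degInS G (Sub.⊤ ─ Sub.⊤) v ≡ multS G v
    multS+0 = trans (cong (λ X → multS G v + degIn G X v) (SubP.p─⊤≡⊥ Sub.⊤))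
                    (trans (cong (_+_ (multS G v)) (degIn-⊥ v)) (+-identityʳ _))

  decomposable⇒degIn<value : ∀ {p A} → DecomposableWrt G p A → ∀ {b} → b ∉ A → degIn G A b < lookup p b
  decomposable⇒degIn<value (_ , _ , _ , positive , _) {b} b∉A = ≰⇒> λ p≤d →
    1+n≰n (ℤP.drop‿+≤+ (ℤP.≤-trans (positive b (SubP.x∉p⇒x∈∁p b∉A))
                                   (ℤP.i≤j⇒i-j≤0 (ℤ.+≤+ p≤d))))

  ones⇒decomposableWrt : ∀ {p A} → (∀ v → 1 ≤ multS G v) → ParkingFunction G p →
    Nonempty A → Nonempty (∁ A) → (∀ {w} → w ∈ A → lookup p w ≡ 1) →
    (∀ {b} → b ∉ A → degIn G A b < lookup p b) → DecomposableWrt G p A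
  ones⇒decomposableWrt {p} {A} sinkAdjacent (positive , parks) nonemptyA nonempty∁A ones cut =
    nonemptyA , nonempty∁A , onA , on∁A
    where
    onA : IsPFOn G A (λ v → + lookup p v)
    onA = (λ v _ → positive v SubP.∈⊤) ,
          λ S S⊆A (x , x∈S) → x , x∈S ,
            subst (λ y → + y ℤ.≤ + degInS G (A ─ S) x) (sym (ones (S⊆A x∈S)))
                  (ℤ.+≤+ (≤-trans (sinkAdjacent x) (m≤m+n _ _)))
    on∁A : IsPFOn G (∁ A) (λ v → + lookup p v ℤ.- + degIn G A v)
    on∁A = positive∁A , parks∁A
      where
      reduced : ∀ {v} → v ∈ ∁ A → + lookup p v ℤ.- + degIn G A v ≡ + (lookup p v ∸ degIn G A v)
      reduced v∈ = +m-+n≡+[m∸n] (<⇒≤ (cut (SubP.x∈∁p⇒x∉p v∈)))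
      positive∁A : ∀ v → v ∈ ∁ A → + 1 ℤ.≤ + lookup p v ℤ.- + degIn G A v
      positive∁A v v∈ =
        subst (+ 1 ℤ.≤_) (sym (reduced v∈)) (ℤ.+≤+ (m<n⇒0<n∸m (cut (SubP.x∈∁p⇒x∉p v∈))))
      parks∁A : ∀ S → S ⊆ ∁ A → Nonempty S →
        ∃ λ v → v ∈ S × + lookup p v ℤ.- + degIn G A v ℤ.≤ + degInS G (∁ A ─ S) v
      parks∁A S S⊆∁A nonemptyS with parks S (λ _ → SubP.∈⊤) nonemptyS
      ... | v , v∈S , p≤ = v , v∈S , subst (ℤ._≤ _) (sym (reduced (S⊆∁A v∈S))) (ℤ.+≤+ p∸d≤)
        where
        open ≤-Reasoning
        d = degIn G A v
        p∸d≤ : lookup p v ∸ d ≤ degInS G (∁ A ─ S) v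
        p∸d≤ = begin
          lookup p v ∸ d                              ≤⟨ ∸-monoˡ-≤ d (ℤP.drop‿+≤+ p≤) ⟩
          (multS G v + degIn G (Sub.⊤ ─ S) v) ∸ d     ≡⟨ cong (λ e → (multS G v + e) ∸ d) (degIn-⊤─-split A S S⊆∁A v) ⟩
          (multS G v + (degIn G (∁ A ─ S) v + d)) ∸ d ≡⟨ cong (_∸ d) (sym (+-assoc (multS G v) _ d)) ⟩
          (degInS G (∁ A ─ S) v + d) ∸ d              ≡⟨ m+n∸n≡m _ d ⟩
          degInS G (∁ A ─ S) v                        ∎

-- Vectors with at most one entry r

module _ {A : Set} (_≟_ : DecidableEquality A) (r : A) where

  count-r∷ : ∀ {n} (v : Vec A n) → count (_≟ r) (r ∷ v) ≡ suc (count (_≟ r) v)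
  count-r∷ v rewrite dec-true (r ≟ r) refl = refl

  count-≢∷ : ∀ {n x} (v : Vec A n) → x ≢ r → count (_≟ r) (x ∷ v) ≡ count (_≟ r) v
  count-≢∷ {x = x} v x≢r rewrite dec-false (x ≟ r) x≢r = refl

  1≤count : ∀ {n} (v : Vec A n) {i} → lookup v i ≡ r → 1 ≤ count (_≟ r) v
  1≤count (x ∷ v) {F.zero}  refl rewrite dec-true (x ≟ x) refl = s≤s z≤n
  1≤count (x ∷ v) {F.suc i} v[i]≡r with does (x ≟ r)
  ... | true  = s≤s z≤n
  ... | false = 1≤count v v[i]≡r

  ¬count[r∷v]≤1 : ∀ {n} (v : Vec A n) {i} → lookup v i ≡ r → ¬ (count (_≟ r) (r ∷ v) ≤ 1)
  ¬count[r∷v]≤1 v v[i]≡r count≤1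
    with ≤-trans (s≤s (1≤count v v[i]≡r)) (subst (_≤ 1) (count-r∷ v) count≤1)
  ... | s≤s ()

  count≤1⇒unique : ∀ {n} (v : Vec A n) → count (_≟ r) v ≤ 1 →
    ∀ {i j} → lookup v i ≡ r → lookup v j ≡ r → i ≡ j
  count≤1⇒unique (x ∷ v) count≤1 {F.zero}  {F.zero}  _    _    = refl
  count≤1⇒unique (x ∷ v) count≤1 {F.zero}  {F.suc j} refl v[j] = ⊥-elim (¬count[r∷v]≤1 v v[j] count≤1)
  count≤1⇒unique (x ∷ v) count≤1 {F.suc i} {F.zero}  v[i] refl = ⊥-elim (¬count[r∷v]≤1 v v[i] count≤1)
  count≤1⇒unique (x ∷ v) count≤1 {F.suc i} {F.suc j} v[i] v[j] with x ≟ r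
  ... | yes refl with ≤-trans (s≤s (1≤count v v[i])) count≤1
  ...   | s≤s ()
  count≤1⇒unique (x ∷ v) count≤1 {F.suc i} {F.suc j} v[i] v[j] | no _ =
    cong F.suc (count≤1⇒unique v count≤1 v[i] v[j])

  unique⇒count≤1 : ∀ {n} (v : Vec A n) → (∀ {i j} → lookup v i ≡ r → lookup v j ≡ r → i ≡ j) →
    count (_≟ r) v ≤ 1
  unique⇒count≤1 []      _      = z≤n
  unique⇒count≤1 (x ∷ v) unique with x ≟ r
  ... | yes x≡r = s≤s (≤-reflexive (count≡0 v (λ v[j] → FP.0≢1+n (unique x≡r v[j]))))
    where
    count≡0 : ∀ {n} (v : Vec A n) → (∀ {j} → lookup v j ≢ r) → count (_≟ r) v ≡ 0
    count≡0 []      _   = refl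
    count≡0 (y ∷ v) ≢r with y ≟ r
    ... | yes y≡r = ⊥-elim (≢r {F.zero} y≡r)
    ... | no  _   = count≡0 v (λ {j} → ≢r {F.suc j})
  ... | no  _   = unique⇒count≤1 v (λ v[i] v[j] → FP.suc-injective (unique v[i] v[j]))

hasCardinality-⇔ : ∀ {A : Set} {P Q : A → Set} {m} → (∀ x → P x ⇔ Q x) →
  HasCardinality Q m → HasCardinality P m
hasCardinality-⇔ P⇔Q (xs , unique , length≡ , Q⇔∈) = xs , unique , length≡ , λ x → Q⇔∈ x ⇔-∘ P⇔Q x

module AtMostOne {A : Set} (_≟_ : DecidableEquality A) (r c : A) (r≢c : r ≢ c) where

  AtMostOne : ∀ {n} → Vec A n → Set
  AtMostOne v = All (λ x → x ≡ r ⊎ x ≡ c) v × count (_≟ r) v ≤ 1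

  count-c∷ : ∀ {n} (v : Vec A n) → count (_≟ r) (c ∷ v) ≡ count (_≟ r) v
  count-c∷ v = count-≢∷ _≟_ r v (r≢c ∘ sym)

  count-replicate-c : ∀ n → count (_≟ r) (Vec.replicate n c) ≡ 0
  count-replicate-c zero    = refl
  count-replicate-c (suc n) = trans (count-c∷ (Vec.replicate n c)) (count-replicate-c n)

  all-replicate-c : ∀ n → All (λ x → x ≡ r ⊎ x ≡ c) (Vec.replicate n c)
  all-replicate-c zero    = []
  all-replicate-c (suc n) = inj₂ refl ∷ all-replicate-c n

  count≡0⇒replicate-c : ∀ {n} (v : Vec A n) → All (λ x → x ≡ r ⊎ x ≡ c) v → count (_≟ r) v ≡ 0 →
    v ≡ Vec.replicate n c
  count≡0⇒replicate-c []      []               _      = refl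
  count≡0⇒replicate-c (_ ∷ v) (inj₁ refl ∷ rc) count≡0 =
    ⊥-elim (0≢1+n (trans (sym count≡0) (count-r∷ _≟_ r v)))
  count≡0⇒replicate-c (_ ∷ v) (inj₂ refl ∷ rc) count≡0 =
    cong (c ∷_) (count≡0⇒replicate-c v rc (trans (sym (count-c∷ v)) count≡0))

  enumeration : ∀ n → List (Vec A n)
  enumeration zero    = [] ∷ []
  enumeration (suc n) = (r ∷ Vec.replicate n c) ∷ List.map (c ∷_) (enumeration n)

  length-enumeration : ∀ n → List.length (enumeration n) ≡ suc n
  length-enumeration zero    = refl
  length-enumeration (suc n) = cong suc (trans (ListP.length-map (c ∷_) (enumeration n)) (length-enumeration n))

  unique-enumeration : ∀ n → Unique (enumeration n)
  unique-enumeration zero    = ListAll.[] ∷ []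
  unique-enumeration (suc n) = head≢ (enumeration n) ∷ UniqueP.map⁺ VecP.∷-injectiveʳ (unique-enumeration n)
    where
    head≢ : ∀ vs → ListAll.All (r ∷ Vec.replicate n c ≢_) (List.map (c ∷_) vs)
    head≢ []       = ListAll.[]
    head≢ (v ∷ vs) = (r≢c ∘ VecP.∷-injectiveˡ) ListAll.∷ head≢ vs

  ∈-enumeration⁻ : ∀ {n} (v : Vec A n) → v ListMem.∈ enumeration n → AtMostOne v
  ∈-enumeration⁻ {zero}  []  _           = [] , z≤n
  ∈-enumeration⁻ {suc n} v   (here refl) =
    inj₁ refl ∷ all-replicate-c n ,
    ≤-reflexive (trans (count-r∷ _≟_ r (Vec.replicate n c)) (cong suc (count-replicate-c n)))
  ∈-enumeration⁻ {suc n} v   (there v∈) with ∈-map⁻ (c ∷_) v∈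
  ... | w , w∈ , refl with ∈-enumeration⁻ w w∈
  ...   | rc , count≤1 = inj₂ refl ∷ rc , subst (_≤ 1) (sym (count-c∷ w)) count≤1

  ∈-enumeration⁺ : ∀ {n} (v : Vec A n) → AtMostOne v → v ListMem.∈ enumeration n
  ∈-enumeration⁺ []      _                         = here refl
  ∈-enumeration⁺ (_ ∷ v) (inj₁ refl ∷ rc , count≤1) =
    here (cong (r ∷_) (count≡0⇒replicate-c v rc
      (n≤0⇒n≡0 (ℕ.s≤s⁻¹ (subst (_≤ 1) (count-r∷ _≟_ r v) count≤1)))))
  ∈-enumeration⁺ (_ ∷ v) (inj₂ refl ∷ rc , count≤1) =
    there (∈-map⁺ (c ∷_) (∈-enumeration⁺ v (rc , subst (_≤ 1) (count-c∷ v) count≤1)))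

  hasCardinality-AtMostOne : ∀ n → HasCardinality (AtMostOne {n}) (suc n)
  hasCardinality-AtMostOne n =
    enumeration n , unique-enumeration n , length-enumeration n ,
    λ v → mk⇔ (∈-enumeration⁺ v) (∈-enumeration⁻ v)


-- The cycle on Fin (suc n)

exit-along-iterate : ∀ {A : Set} {P : A → Set} (f : A → A) → (∀ x → Dec (P x)) →
  ∀ {a} k → P a → ¬ P (iterate f a k) → ∃ λ w → P w × ¬ P (f w)
exit-along-iterate f P? zero    pa ¬pa = ⊥-elim (¬pa pa)
exit-along-iterate f P? {a} (suc k) pa ¬pa with P? (f a)
... | yes pfa = exit-along-iterate f P? k pfa ¬pa
... | no ¬pfa = a , pa , ¬pfa

module _ {n : ℕ} where

  prv : Fin (suc n) → Fin (suc n)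
  prv F.zero    = F.fromℕ n
  prv (F.suc i) = F.inject₁ i

  nxt : Fin (suc n) → Fin (suc n)
  nxt w with n ℕ.≟ toℕ w
  ... | yes _   = F.zero
  ... | no  n≢w = F.suc (F.lower₁ w n≢w)

  toℕ-nxt : ∀ w → toℕ w < n → toℕ (nxt w) ≡ suc (toℕ w)
  toℕ-nxt w w<n with n ℕ.≟ toℕ w
  ... | yes n≡w = ⊥-elim (<-irrefl (sym n≡w) w<n)
  ... | no  n≢w = cong suc (FP.toℕ-lower₁ w n≢w)

  toℕ-nxt-last : ∀ w → toℕ w ≡ n → toℕ (nxt w) ≡ 0
  toℕ-nxt-last w w≡n with n ℕ.≟ toℕ w
  ... | yes _   = refl
  ... | no  n≢w = ⊥-elim (n≢w (sym w≡n))

  nxt-prv : ∀ w → nxt (prv w) ≡ w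
  nxt-prv F.zero with n ℕ.≟ toℕ (F.fromℕ n)
  ... | yes _   = refl
  ... | no  n≢w = ⊥-elim (n≢w (sym (FP.toℕ-fromℕ n)))
  nxt-prv (F.suc i) with n ℕ.≟ toℕ (F.inject₁ i)
  ... | yes n≡w = ⊥-elim (FP.toℕ-inject₁-≢ i n≡w)
  ... | no  n≢w = cong F.suc (FP.lower₁-inject₁′ i n≢w)

  prv-nxt : ∀ w → prv (nxt w) ≡ w
  prv-nxt w with n ℕ.≟ toℕ w
  ... | yes n≡w = FP.toℕ-injective (trans (FP.toℕ-fromℕ n) n≡w)
  ... | no  n≢w = FP.inject₁-lower₁ w n≢w

  record Unrolling (z : Fin (suc n)) : Set where
    field
      pos           : Fin (suc n) → ℕ
      pos≤n         : ∀ w → pos w ≤ n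
      pos-injective : ∀ {u w} → pos u ≡ pos w → u ≡ w
      pos-base      : pos z ≡ 0
      pos-nxt       : ∀ w → pos w < n → pos (nxt w) ≡ suc (pos w)
      pos-nxt-last  : ∀ w → pos w ≡ n → pos (nxt w) ≡ 0

    pos-nxt-base : 0 < n → pos (nxt z) ≡ 1
    pos-nxt-base 0<n = trans (pos-nxt z (subst (_< n) (sym pos-base) 0<n)) (cong suc pos-base)

    pos-nxt-below : ∀ {u} w → pos w < pos u → pos (nxt w) ≡ suc (pos w)
    pos-nxt-below {u} w w<u = pos-nxt w (<-≤-trans w<u (pos≤n u))

    pos-prv : ∀ w → 0 < pos w → suc (pos (prv w)) ≡ pos w
    pos-prv w 0<w with m≤n⇒m<n∨m≡n (pos≤n (prv w))
    ... | inj₁ prv<n = trans (sym (pos-nxt (prv w) prv<n)) (cong pos (nxt-prv w))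
    ... | inj₂ prv≡n = ⊥-elim (<-irrefl (sym (trans (sym (cong pos (nxt-prv w))) (pos-nxt-last (prv w) prv≡n))) 0<w)

    pos-prv-base : pos (prv z) ≡ n
    pos-prv-base with m≤n⇒m<n∨m≡n (pos≤n (prv z))
    ... | inj₁ prv<n =
      ⊥-elim (0≢1+n (trans (sym pos-base) (trans (cong pos (sym (nxt-prv z))) (pos-nxt (prv z) prv<n))))
    ... | inj₂ prv≡n = prv≡n

    pos≤base⇒≡base : ∀ {u} → pos u ≤ pos z → u ≡ z
    pos≤base⇒≡base {u} u≤z = pos-injective (trans (n≤0⇒n≡0 (subst (pos u ≤_) pos-base u≤z)) (sym pos-base))

    pos-iterate : ∀ k {w} → pos w + k ≤ n → pos (iterate nxt w k) ≡ pos w + k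
    pos-iterate zero    {w} _    = sym (+-identityʳ (pos w))
    pos-iterate (suc k) {w} w+k≤n = begin
      pos (iterate nxt (nxt w) k) ≡⟨ pos-iterate k (subst (_≤ n) (sym nxt+k) w+k≤n) ⟩
      pos (nxt w) + k             ≡⟨ nxt+k ⟩
      pos w + suc k               ∎
      where
      open ≡-Reasoning
      nxt+k : pos (nxt w) + k ≡ pos w + suc k
      nxt+k = trans (cong (_+ k) (pos-nxt w (<-≤-trans (m<m+n (pos w) 0<1+n) w+k≤n)))
                    (sym (+-suc (pos w) k))

    iterate-pos : ∀ w → iterate nxt z (pos w) ≡ w
    iterate-pos w = pos-injective (trans (pos-iterate (pos w) (subst (_≤ n) (sym z+w) (pos≤n w))) z+w)
      where
      z+w : pos z + pos w ≡ pos w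
      z+w = cong (_+ pos w) pos-base

    arc : ℕ → ℕ → Subset (suc n)
    arc a b = subsetOf (λ w → (a ℕ.≤? pos w) ×-dec (pos w ℕ.≤? b))

    ∈-arc⁺ : ∀ {a b w} → a ≤ pos w → pos w ≤ b → w ∈ arc a b
    ∈-arc⁺ {a} {b} a≤w w≤b = ∈-subsetOf⁺ (λ w → (a ℕ.≤? pos w) ×-dec (pos w ℕ.≤? b)) (a≤w , w≤b)

    ∈-arc⁻ : ∀ {a b w} → w ∈ arc a b → a ≤ pos w × pos w ≤ b
    ∈-arc⁻ {a} {b} = ∈-subsetOf⁻ (λ w → (a ℕ.≤? pos w) ×-dec (pos w ℕ.≤? b))

    nxt∈arc : ∀ {a b w} → a ≤ pos w → pos w < b → b ≤ n → nxt w ∈ arc a b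
    nxt∈arc {a} {b} {w} a≤w w<b b≤n = ∈-arc⁺ (≤-trans a≤w (subst (pos w ≤_) (sym pos-nxt-w) (n≤1+n _)))
                                              (subst (_≤ b) (sym pos-nxt-w) w<b)
      where
      pos-nxt-w : pos (nxt w) ≡ suc (pos w)
      pos-nxt-w = pos-nxt w (<-≤-trans w<b b≤n)

    prv∈arc : ∀ {a b w} → a < pos w → pos w ≤ b → prv w ∈ arc a b
    prv∈arc {a} {b} {w} a<w w≤b = ∈-arc⁺ (ℕ.s≤s⁻¹ (subst (suc a ≤_) (sym pos-prv-w) a<w))
                                          (≤-trans (n≤1+n _) (subst (_≤ b) (sym pos-prv-w) w≤b))
      where
      pos-prv-w : suc (pos (prv w)) ≡ pos w
      pos-prv-w = pos-prv w (≤-<-trans z≤n a<w)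

  unrollAtZero : Unrolling F.zero
  unrollAtZero = record
    { pos           = toℕ
    ; pos≤n         = FP.toℕ≤pred[n]
    ; pos-injective = FP.toℕ-injective
    ; pos-base      = refl
    ; pos-nxt       = toℕ-nxt
    ; pos-nxt-last  = toℕ-nxt-last
    }

  rotate : ∀ {z} → Unrolling z → Unrolling (nxt z)
  rotate {z} U = record
    { pos           = pos ∘ prv
    ; pos≤n         = pos≤n ∘ prv
    ; pos-injective = λ {u} {w} e → trans (sym (nxt-prv u)) (trans (cong nxt (pos-injective e)) (nxt-prv w))
    ; pos-base      = trans (cong pos (prv-nxt z)) pos-base
    ; pos-nxt       = λ w prv<n → trans (pos-prv∘nxt w) (pos-nxt (prv w) prv<n)
    ; pos-nxt-last  = λ w prv≡n → trans (pos-prv∘nxt w) (pos-nxt-last (prv w) prv≡n)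
    }
    where
    open Unrolling U
    pos-prv∘nxt : ∀ w → pos (prv (nxt w)) ≡ pos (nxt (prv w))
    pos-prv∘nxt w = trans (cong pos (prv-nxt w)) (cong pos (sym (nxt-prv w)))

  opaque
    unrollAt : ∀ z → Unrolling z
    unrollAt z = subst Unrolling (Unrolling.iterate-pos unrollAtZero z) (rotateBy (toℕ z) unrollAtZero)
      where
      rotateBy : ∀ k {w} → Unrolling w → Unrolling (iterate nxt w k)
      rotateBy zero    U = U
      rotateBy (suc k) U = rotateBy k (rotate U)

  cycle-exit : {P : Fin (suc n) → Set} → (∀ w → Dec (P w)) → ∀ {a b} → P a → ¬ P b →
    ∃ λ w → P w × ¬ P (nxt w)
  cycle-exit {P} P? {a} {b} pa ¬pb =
    exit-along-iterate nxt P? (pos b) pa (subst (λ w → ¬ P w) (sym (iterate-pos b)) ¬pb)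
    where open Unrolling (unrollAt a)

  toℕ-nxt-cases : ∀ v → (toℕ v < n × toℕ (nxt v) ≡ suc (toℕ v)) ⊎ (toℕ v ≡ n × toℕ (nxt v) ≡ 0)
  toℕ-nxt-cases v with m≤n⇒m<n∨m≡n (FP.toℕ≤pred[n] v)
  ... | inj₁ v<n = inj₁ (v<n , toℕ-nxt v v<n)
  ... | inj₂ v≡n = inj₂ (v≡n , toℕ-nxt-last v v≡n)

  nxt≡ : ∀ {v w} → suc (toℕ v) ≡ toℕ w ⊎ (toℕ v ≡ n × toℕ w ≡ 0) → nxt v ≡ w
  nxt≡ {v} {w} (inj₁ v+1≡w) =
    FP.toℕ-injective (trans (toℕ-nxt v (subst (_≤ n) (sym v+1≡w) (FP.toℕ≤pred[n] w))) v+1≡w)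
  nxt≡ {v} {w} (inj₂ (v≡n , w≡0)) = FP.toℕ-injective (trans (toℕ-nxt-last v v≡n) (sym w≡0))

  private
    ≡ᵇ-from : ∀ {a b} → a ≡ b → T (a ℕ.≡ᵇ b)
    ≡ᵇ-from {a} {b} = ≡⇒≡ᵇ a b

    ≡ᵇ-to : ∀ {a b} → T (a ℕ.≡ᵇ b) → a ≡ b
    ≡ᵇ-to {a} {b} = ≡ᵇ⇒≡ a b

    ∨-inj₁ : ∀ x {y} → T x → T (x ∨ y)
    ∨-inj₁ x = Equivalence.from BoolP.T-∨ ∘ inj₁

    ∨-inj₂ : ∀ x {y} → T y → T (x ∨ y)
    ∨-inj₂ x = Equivalence.from BoolP.T-∨ ∘ inj₂

    ∧-intro : ∀ x {y} → T x → T y → T (x ∧ y)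
    ∧-intro x tx ty = Equivalence.from BoolP.T-∧ (tx , ty)

    T-cycAdj⁺ : ∀ {a b} → suc a ≡ b ⊎ suc b ≡ a ⊎ (a ≡ 0 × b ≡ n) ⊎ (b ≡ 0 × a ≡ n) →
      T (cycAdj (suc n) a b)
    T-cycAdj⁺ {a} {b} (inj₁ a+1≡b) = ∨-inj₁ _ (≡ᵇ-from a+1≡b)
    T-cycAdj⁺ {a} {b} (inj₂ (inj₁ b+1≡a)) = ∨-inj₂ (suc a ℕ.≡ᵇ b) (∨-inj₁ _ (≡ᵇ-from b+1≡a))
    T-cycAdj⁺ {a} {b} (inj₂ (inj₂ (inj₁ (a≡0 , b≡n)))) =
      ∨-inj₂ (suc a ℕ.≡ᵇ b) (∨-inj₂ (suc b ℕ.≡ᵇ a) (∨-inj₁ _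
        (∧-intro (a ℕ.≡ᵇ 0) (≡ᵇ-from a≡0) (≡ᵇ-from (cong suc b≡n)))))
    T-cycAdj⁺ {a} {b} (inj₂ (inj₂ (inj₂ (b≡0 , a≡n)))) =
      ∨-inj₂ (suc a ℕ.≡ᵇ b) (∨-inj₂ (suc b ℕ.≡ᵇ a) (∨-inj₂ ((a ℕ.≡ᵇ 0) ∧ (suc b ℕ.≡ᵇ suc n))
        (∧-intro (b ℕ.≡ᵇ 0) (≡ᵇ-from b≡0) (≡ᵇ-from (cong suc a≡n)))))

  adjacent-nxtʳ : ∀ v → T (cycAdj (suc n) (toℕ v) (toℕ (nxt v)))
  adjacent-nxtʳ v with toℕ-nxt-cases v
  ... | inj₁ (_ , nxt≡v+1) = T-cycAdj⁺ (inj₁ (sym nxt≡v+1))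
  ... | inj₂ (v≡n , nxt≡0) = T-cycAdj⁺ (inj₂ (inj₂ (inj₂ (nxt≡0 , v≡n))))

  adjacent-nxtˡ : ∀ w → T (cycAdj (suc n) (toℕ (nxt w)) (toℕ w))
  adjacent-nxtˡ w with toℕ-nxt-cases w
  ... | inj₁ (_ , nxt≡w+1) = T-cycAdj⁺ (inj₂ (inj₁ (sym nxt≡w+1)))
  ... | inj₂ (w≡n , nxt≡0) = T-cycAdj⁺ (inj₂ (inj₂ (inj₁ (nxt≡0 , w≡n))))

  adjacent-prvʳ : ∀ v → T (cycAdj (suc n) (toℕ v) (toℕ (prv v)))
  adjacent-prvʳ v = subst (λ u → T (cycAdj (suc n) (toℕ u) (toℕ (prv v)))) (nxt-prv v) (adjacent-nxtˡ (prv v))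

  adjacent⇒nxt : ∀ v w → T (cycAdj (suc n) (toℕ v) (toℕ w)) → nxt v ≡ w ⊎ nxt w ≡ v
  adjacent⇒nxt v w adj with Equivalence.to BoolP.T-∨ adj
  ... | inj₁ v+1≡w = inj₁ (nxt≡ (inj₁ (≡ᵇ-to v+1≡w)))
  ... | inj₂ adj′ with Equivalence.to BoolP.T-∨ adj′
  ...   | inj₁ w+1≡v = inj₂ (nxt≡ (inj₁ (≡ᵇ-to w+1≡v)))
  ...   | inj₂ adj″ with Equivalence.to BoolP.T-∨ adj″
  ...     | inj₁ v0∧wn = let (v≡0 , w+1≡N) = Equivalence.to BoolP.T-∧ v0∧wn in
                         inj₂ (nxt≡ (inj₂ (suc-injective (≡ᵇ-to w+1≡N) , ≡ᵇ-to v≡0)))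
  ...     | inj₂ w0∧vn = let (w≡0 , v+1≡N) = Equivalence.to BoolP.T-∧ w0∧vn in
                         inj₁ (nxt≡ (inj₂ (suc-injective (≡ᵇ-to v+1≡N) , ≡ᵇ-to w≡0)))

-- The wheel

∣m-o∣<∣1+m-o∣ : ∀ {m o} → o ≤ m → ∣ m - o ∣ < ∣ suc m - o ∣
∣m-o∣<∣1+m-o∣ {m} {o} o≤m
  rewrite m≤n⇒∣n-m∣≡n∸m o≤m | m≤n⇒∣n-m∣≡n∸m (m≤n⇒m≤1+n o≤m) | +-∸-assoc 1 o≤m = ≤-refl

∣1+m-o∣<∣m-o∣ : ∀ {m o} → suc m ≤ o → ∣ suc m - o ∣ < ∣ m - o ∣
∣1+m-o∣<∣m-o∣ {m} {o} m<o
  rewrite m≤n⇒∣m-n∣≡n∸m m<o | m≤n⇒∣m-n∣≡n∸m (<⇒≤ m<o) = ∸-monoʳ-< (n<1+n m) m<o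

indicator : ∀ {k} → Subset k → Fin k → ℕ
indicator X w = if lookup X w then 1 else 0

indicator-∈ : ∀ {k} {X : Subset k} {w} → w ∈ X → indicator X w ≡ 1
indicator-∈ w∈X rewrite VecP.[]=⇒lookup w∈X = refl

indicator-∉ : ∀ {k} {X : Subset k} {w} → w ∉ X → indicator X w ≡ 0
indicator-∉ w∉X rewrite ∉⇒lookup≡false w∉X = refl

indicator≤1 : ∀ {k} (X : Subset k) w → indicator X w ≤ 1
indicator≤1 X w with lookup X w
... | true  = ≤-refl
... | false = z≤n

module _ {m : ℕ} where

  private
    G : SinkGraph (3 + m)
    G = Wheel (3 + m)

  nxt≢ : ∀ (w : Fin (3 + m)) → nxt w ≢ w
  nxt≢ w nxt≡w = 0≢1+n (trans (sym pos-base) (trans (cong pos (sym nxt≡w)) (pos-nxt-base 0<1+n)))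
    where open Unrolling (unrollAt w)

  nxt≢prv : ∀ (w : Fin (3 + m)) → nxt w ≢ prv w
  nxt≢prv w nxt≡prv = 0≢1+n (trans (sym pos-base) (trans (cong pos (sym nxt²≡w)) pos-nxt₂))
    where
    open Unrolling (unrollAt w)
    pos-nxt₂ : pos (nxt (nxt w)) ≡ 2
    pos-nxt₂ = trans (pos-nxt (nxt w) (subst (_< 2 + m) (sym (pos-nxt-base 0<1+n)) (s≤s (s≤s z≤n))))
                     (cong suc (pos-nxt-base 0<1+n))
    nxt²≡w : nxt (nxt w) ≡ w
    nxt²≡w = trans (cong nxt nxt≡prv) (nxt-prv w)

  multV-wheel-nxt : ∀ v → multV G v (nxt v) ≡ 1
  multV-wheel-nxt v rewrite Equivalence.to BoolP.T-≡ (adjacent-nxtʳ v) = refl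

  multV-wheel-prv : ∀ v → multV G v (prv v) ≡ 1
  multV-wheel-prv v rewrite Equivalence.to BoolP.T-≡ (adjacent-prvʳ v) = refl

  multV-wheel-other : ∀ v w → nxt v ≢ w → prv v ≢ w → multV G v w ≡ 0
  multV-wheel-other v w nxt≢w prv≢w with cycAdj (3 + m) (toℕ v) (toℕ w) in adj
  ... | false = refl
  ... | true with adjacent⇒nxt v w (Equivalence.from BoolP.T-≡ adj)
  ...   | inj₁ nxt≡w = ⊥-elim (nxt≢w nxt≡w)
  ...   | inj₂ nxt≡v = ⊥-elim (prv≢w (trans (cong prv (sym nxt≡v)) (prv-nxt w)))

  degIn-wheel : ∀ X v → degIn G X v ≡ indicator X (nxt v) + indicator X (prv v)
  degIn-wheel X v = begin
    degIn G X v                                ≡⟨ sumFin-cong neighbours ⟩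
    sumFin (λ w → at (nxt v) w + at (prv v) w) ≡⟨ sumFin-+ {3 + m} (at (nxt v)) (at (prv v)) ⟩
    sumFin (at (nxt v)) + sumFin (at (prv v))  ≡⟨ cong₂ _+_ (sumFin-point (nxt v) (indicator X))
                                                             (sumFin-point (prv v) (indicator X)) ⟩
    indicator X (nxt v) + indicator X (prv v)  ∎
    where
    open ≡-Reasoning
    at : Fin (3 + m) → Fin (3 + m) → ℕ
    at a w = if does (a F.≟ w) then indicator X w else 0
    neighbours : ∀ w → (if lookup X w then multV G v w else 0) ≡ at (nxt v) w + at (prv v) w
    neighbours w with nxt v F.≟ w | prv v F.≟ w
    ... | yes refl | yes prv≡ = ⊥-elim (nxt≢prv v (sym prv≡))
    ... | yes refl | no _     rewrite multV-wheel-nxt v = sym (+-identityʳ _)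
    ... | no _     | yes refl rewrite multV-wheel-prv v = refl
    ... | no nxt≢w | no prv≢w rewrite multV-wheel-other v w nxt≢w prv≢w with lookup X w
    ...   | true  = refl
    ...   | false = refl

  degIn-wheel≤2 : ∀ X v → degIn G X v ≤ 2
  degIn-wheel≤2 X v =
    subst (_≤ 2) (sym (degIn-wheel X v)) (+-mono-≤ (indicator≤1 X (nxt v)) (indicator≤1 X (prv v)))

  degIn-wheel≤1 : ∀ {X v} → nxt v ∉ X ⊎ prv v ∉ X → degIn G X v ≤ 1
  degIn-wheel≤1 {X} {v} (inj₁ nxt∉X) rewrite degIn-wheel X v | indicator-∉ nxt∉X = indicator≤1 X (prv v)
  degIn-wheel≤1 {X} {v} (inj₂ prv∉X) rewrite degIn-wheel X v | indicator-∉ prv∉X =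
    subst (_≤ 1) (sym (+-identityʳ _)) (indicator≤1 X (nxt v))

  degIn-wheel≡0 : ∀ {X v} → nxt v ∉ X → prv v ∉ X → degIn G X v ≡ 0
  degIn-wheel≡0 {X} {v} nxt∉X prv∉X rewrite degIn-wheel X v | indicator-∉ nxt∉X | indicator-∉ prv∉X = refl

  1≤degIn-wheel : ∀ {X v} → nxt v ∈ X ⊎ prv v ∈ X → 1 ≤ degIn G X v
  1≤degIn-wheel {X} {v} (inj₁ nxt∈X) rewrite degIn-wheel X v | indicator-∈ nxt∈X = s≤s z≤n
  1≤degIn-wheel {X} {v} (inj₂ prv∈X) rewrite degIn-wheel X v | indicator-∈ prv∈X = m≤n+m 1 _

  degIn-wheel≡2 : ∀ {X v} → nxt v ∈ X → prv v ∈ X → degIn G X v ≡ 2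
  degIn-wheel≡2 {X} {v} nxt∈X prv∈X rewrite degIn-wheel X v | indicator-∈ nxt∈X | indicator-∈ prv∈X = refl

  degIn-wheel-⊤ : ∀ v → degIn G Sub.⊤ v ≡ 2
  degIn-wheel-⊤ v = degIn-wheel≡2 {Sub.⊤} {v} SubP.∈⊤ SubP.∈⊤

  deg-wheel : ∀ v → deg G v ≡ 3
  deg-wheel v = cong suc (degIn-wheel-⊤ v)

  stable-wheel⁻ : ∀ {c} → Stable G c → ∀ v → lookup c v ℤ.≤ + 2
  stable-wheel⁻ {c} stable v = <+3⇒≤+2 (subst (λ d → lookup c v ℤ.< + d) (deg-wheel v) (stable v))
    where
    <+3⇒≤+2 : ∀ {x} → x ℤ.< + 3 → x ℤ.≤ + 2
    <+3⇒≤+2 {+ _}        (ℤ.+<+ (s≤s x≤2)) = ℤ.+≤+ x≤2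
    <+3⇒≤+2 {ℤ.-[1+ _ ]} _                 = ℤ.-≤+

  stable-wheel⁺ : ∀ {c} → (∀ v → lookup c v ℤ.≤ + 2) → Stable G c
  stable-wheel⁺ {c} ≤2 v =
    subst (λ d → lookup c v ℤ.< + d) (sym (deg-wheel v)) (ℤP.≤-<-trans (≤2 v) (ℤ.+<+ ≤-refl))

  inVM-wheel⁻ : ∀ {c v} → InVM G c v → + 2 ℤ.≤ lookup c v
  inVM-wheel⁻ {c} {v} (_ , le) = subst (λ d → + d ℤ.- + 1 ℤ.≤ lookup c v) (deg-wheel v) le

  inVM-wheel⁺ : ∀ {c v} → + 2 ℤ.≤ lookup c v → InVM G c v
  inVM-wheel⁺ {c} {v} le = ≤-refl , subst (λ d → + d ℤ.- + 1 ℤ.≤ lookup c v) (sym (deg-wheel v)) le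

  -- Strongly recurrent configurations

  recurrent-wheel⇒two : ∀ {c} → Recurrent G c → ∃ λ v → lookup c v ≡ + 2
  recurrent-wheel⇒two {c} rec with recurrent⇒burnable G rec (F.zero , SubP.∈⊤)
  ... | v , _ , deg≤c = v , ℤP.≤-antisym (stable-wheel⁻ {c} (proj₁ rec) v)
                                         (subst (λ d → + d ℤ.≤ lookup c v) (degIn-wheel-⊤ v) deg≤c)

  module _ {z : Fin (3 + m)} (U : Unrolling z) where
    open Unrolling U

    ¬recurrent-arc : ∀ {d i j} → Recurrent G d → pos i < pos j →
      lookup d i ℤ.≤ + 0 → lookup d j ℤ.≤ + 0 →
      (∀ w → pos i < pos w → pos w < pos j → lookup d w ℤ.≤ + 1) → ⊥
    ¬recurrent-arc {d} {i} {j} rec i<j d[i]≤0 d[j]≤0 interior≤1 =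
      burnt (recurrent⇒burnable G rec (i , ∈-arc⁺ ≤-refl (<⇒≤ i<j)))
      where
      S = arc (pos i) (pos j)
      too-small : ∀ {w a} → + degIn G S w ℤ.≤ lookup d w → lookup d w ℤ.≤ + a → a < degIn G S w → ⊥
      too-small deg≤d d≤a a<deg = <⇒≱ a<deg (ℤP.drop‿+≤+ (ℤP.≤-trans deg≤d d≤a))
      burnt : (∃ λ w → w ∈ S × + degIn G S w ℤ.≤ lookup d w) → ⊥
      burnt (w , w∈S , deg≤d) with ∈-arc⁻ w∈S
      ... | i≤w , w≤j with m≤n⇒m<n∨m≡n i≤w | m≤n⇒m<n∨m≡n w≤j
      ...   | inj₂ i≡w | _        =
        too-small deg≤d (subst (λ u → lookup d u ℤ.≤ + 0) (pos-injective i≡w) d[i]≤0)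
                        (1≤degIn-wheel (inj₁ (nxt∈arc i≤w (subst (_< pos j) i≡w i<j) (pos≤n j))))
      ...   | inj₁ i<w | inj₂ w≡j =
        too-small deg≤d (subst (λ u → lookup d u ℤ.≤ + 0) (pos-injective (sym w≡j)) d[j]≤0)
                        (1≤degIn-wheel (inj₂ (prv∈arc i<w w≤j)))
      ...   | inj₁ i<w | inj₁ w<j =
        too-small deg≤d (interior≤1 w i<w w<j)
                        (≤-reflexive (sym (degIn-wheel≡2 (nxt∈arc i≤w w<j (pos≤n j)) (prv∈arc i<w w≤j))))

  private
    oneOrTwo-of : ∀ {x} → + 0 ℤ.≤ x ℤ.- + 1 → x ℤ.≤ + 2 → x ≡ + 1 ⊎ x ≡ + 2
    oneOrTwo-of {+ 1}                _ _ = inj₁ refl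
    oneOrTwo-of {+ 2}                _ _ = inj₂ refl
    oneOrTwo-of {+ suc (suc (suc _))} _ (ℤ.+≤+ (s≤s (s≤s ())))
    oneOrTwo-of {+ 0}                ()
    oneOrTwo-of {ℤ.-[1+ _ ]}         ()

    +1≢+2 : + 1 ≢ + 2
    +1≢+2 ()

  stronglyRecurrent⇒oneOrTwo : ∀ {c} → StronglyRecurrent G c → ∀ w → lookup c w ≡ + 1 ⊎ lookup c w ≡ + 2
  stronglyRecurrent⇒oneOrTwo {c} (rec , sr) w = at (w F.≟ v)
    where
    v = proj₁ (recurrent-wheel⇒two rec)
    c[v]≡2 : lookup c v ≡ + 2
    c[v]≡2 = proj₂ (recurrent-wheel⇒two rec)
    at : Dec (w ≡ v) → lookup c w ≡ + 1 ⊎ lookup c w ≡ + 2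
    at (yes w≡v) = inj₂ (trans (cong (lookup c) w≡v) c[v]≡2)
    at (no  w≢v) = oneOrTwo-of {x = lookup c w} (subst (+ 0 ℤ.≤_) (cMinus-other G c w≢v) c⁻[w]≥0)
                                (stable-wheel⁻ {c} (proj₁ rec) w)
      where
      c⁻[w]≥0 : + 0 ℤ.≤ lookup (cMinus G c v) w
      c⁻[w]≥0 = recurrent⇒nonnegative G (sr v (inVM-wheel⁺ {c} {v} (ℤP.≤-reflexive (sym c[v]≡2)))) w

  stronglyRecurrent⇒uniqueOne : ∀ {c} → StronglyRecurrent G c →
    ∀ {i j} → lookup c i ≡ + 1 → lookup c j ≡ + 1 → i ≡ j
  stronglyRecurrent⇒uniqueOne {c} (rec , sr) {i} {j} c[i]≡1 c[j]≡1 = by-position (<-cmp (pos i) (pos j))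
    where
    v = proj₁ (recurrent-wheel⇒two rec)
    c[v]≡2 : lookup c v ≡ + 2
    c[v]≡2 = proj₂ (recurrent-wheel⇒two rec)
    U = unrollAt v
    open Unrolling U
    c⁻ = cMinus G c v
    rec⁻ : Recurrent G c⁻
    rec⁻ = sr v (inVM-wheel⁺ {c} {v} (ℤP.≤-reflexive (sym c[v]≡2)))
    zero-at : ∀ {u} → lookup c u ≡ + 1 → lookup c⁻ u ℤ.≤ + 0
    zero-at {u} c[u]≡1 = ℤP.≤-reflexive (trans (cMinus-other G c u≢v) (cong (ℤ._- + 1) c[u]≡1))
      where
      u≢v : u ≢ v
      u≢v refl = +1≢+2 (trans (sym c[u]≡1) c[v]≡2)
    at-most-one : ∀ {a} w → pos a < pos w → lookup c⁻ w ℤ.≤ + 1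
    at-most-one w a<w = subst (ℤ._≤ + 1) (sym (cMinus-other G c w≢v))
                              (ℤP.+-monoˡ-≤ (ℤ.- + 1) (stable-wheel⁻ {c} (proj₁ rec) w))
      where
      w≢v : w ≢ v
      w≢v refl = <⇒≱ a<w (≤-trans (≤-reflexive pos-base) z≤n)
    by-position : Tri (pos i < pos j) (pos i ≡ pos j) (pos j < pos i) → i ≡ j
    by-position (tri< i<j _ _) =
      ⊥-elim (¬recurrent-arc U rec⁻ i<j (zero-at c[i]≡1) (zero-at c[j]≡1) (λ w i<w _ → at-most-one w i<w))
    by-position (tri≈ _ i≡j _) = pos-injective i≡j
    by-position (tri> _ _ j<i) =
      ⊥-elim (¬recurrent-arc U rec⁻ j<i (zero-at c[j]≡1) (zero-at c[i]≡1) (λ w j<w _ → at-most-one w j<w))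

  -- Burn v first, then the path obtained by deleting j in order of distance from v, and j last.
  recurrent-wheel-criterion : ∀ {d} v j → j ≢ v → Stable G d → + 2 ℤ.≤ lookup d v → + 0 ℤ.≤ lookup d j →
    (∀ w → w ≢ v → w ≢ j → + 1 ℤ.≤ lookup d w) → Recurrent G d
  recurrent-wheel-criterion {d} v j j≢v stable d[v]≥2 d[j]≥0 d[w]≥1 = recurrent-byRank G rank stable bound
    where
    open Unrolling (unrollAt (nxt j))

    pos-j : pos j ≡ 2 + m
    pos-j = trans (cong pos (sym (prv-nxt j))) pos-prv-base

    pos<pos-j : ∀ {u} → u ≢ j → pos u < 2 + m
    pos<pos-j u≢j = ≤∧≢⇒< (pos≤n _) (λ u≡ → u≢j (pos-injective (trans u≡ (sym pos-j))))

    rank : Fin (3 + m) → ℕ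
    rank w = if does (w F.≟ j) then 3 + m else ∣ pos w - pos v ∣

    rank-other : ∀ {w} → w ≢ j → rank w ≡ ∣ pos w - pos v ∣
    rank-other {w} w≢j rewrite dec-false (w F.≟ j) w≢j = refl

    rank-other<rank-j : ∀ {w} → w ≢ j → rank w < rank j
    rank-other<rank-j {w} w≢j rewrite rank-other w≢j | dec-true (j F.≟ j) refl =
      s≤s (≤-trans (∣m-n∣≤m⊔n (pos w) (pos v)) (⊔-lub (pos≤n w) (pos≤n v)))

    lower∉rankAtLeast : ∀ {u w} → rank u < rank w → u ∉ rankAtLeast G rank w
    lower∉rankAtLeast {u} {w} u<w u∈ = <⇒≱ u<w (∈-subsetOf⁻ (λ x → rank w ℕ.≤? rank x) u∈)

    lower-neighbour : ∀ {w} → w ≢ j → w ≢ v → rank (nxt w) < rank w ⊎ rank (prv w) < rank w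
    lower-neighbour {w} w≢j w≢v with <-cmp (pos w) (pos v)
    ... | tri≈ _ w≡v _ = ⊥-elim (w≢v (pos-injective w≡v))
    ... | tri< w<v _ _ = inj₁ (subst₂ _<_ (sym (rank-other nxt≢j)) (sym (rank-other w≢j)) closer)
      where
      pos-nxt-w : pos (nxt w) ≡ suc (pos w)
      pos-nxt-w = pos-nxt-below w w<v
      nxt≢j : nxt w ≢ j
      nxt≢j nxt≡j = <⇒≱ (pos<pos-j (j≢v ∘ sym)) (≤-trans (≤-reflexive (sym pos-j))
                          (subst (_≤ pos v) (trans (sym pos-nxt-w) (cong pos nxt≡j)) w<v))
      closer : ∣ pos (nxt w) - pos v ∣ < ∣ pos w - pos v ∣
      closer rewrite pos-nxt-w = ∣1+m-o∣<∣m-o∣ w<v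
    ... | tri> _ _ v<w = inj₂ (subst₂ _<_ (sym (rank-other prv≢j)) (sym (rank-other w≢j)) closer)
      where
      pos-prv-w : suc (pos (prv w)) ≡ pos w
      pos-prv-w = pos-prv w (≤-<-trans z≤n v<w)
      prv≢j : prv w ≢ j
      prv≢j prv≡j = <⇒≱ (pos<pos-j w≢j) (≤-trans (≤-reflexive (sym pos-j))
                          (subst (_≤ pos w) (cong pos prv≡j) (subst (pos (prv w) ≤_) pos-prv-w (n≤1+n _))))
      closer : ∣ pos (prv w) - pos v ∣ < ∣ pos w - pos v ∣
      closer = subst (λ x → ∣ pos (prv w) - pos v ∣ < ∣ x - pos v ∣) pos-prv-w
                     (∣m-o∣<∣1+m-o∣ (ℕ.s≤s⁻¹ (subst (pos v <_) (sym pos-prv-w) v<w)))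

    Bounded : Fin (3 + m) → Set
    Bounded w = + degIn G (rankAtLeast G rank w) w ℤ.≤ lookup d w

    bound-j : Bounded j
    bound-j = subst (λ x → + x ℤ.≤ lookup d j) (sym isolated) d[j]≥0
      where
      prv≢j : prv j ≢ j
      prv≢j prv≡j = nxt≢ j (trans (cong nxt (sym prv≡j)) (nxt-prv j))
      isolated : degIn G (rankAtLeast G rank j) j ≡ 0
      isolated = degIn-wheel≡0 (lower∉rankAtLeast (rank-other<rank-j (nxt≢ j)))
                               (lower∉rankAtLeast (rank-other<rank-j prv≢j))

    bound : ∀ w → Bounded w
    bound w = by-cases (w F.≟ j) (w F.≟ v)
      where
      by-cases : Dec (w ≡ j) → Dec (w ≡ v) → Bounded w
      by-cases (yes w≡j) _         = subst Bounded (sym w≡j) bound-j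
      by-cases (no _)    (yes w≡v) =
        subst Bounded (sym w≡v) (ℤP.≤-trans (ℤ.+≤+ (degIn-wheel≤2 (rankAtLeast G rank v) v)) d[v]≥2)
      by-cases (no w≢j)  (no w≢v)  =
        ℤP.≤-trans (ℤ.+≤+ (degIn-wheel≤1 (Sum.map lower∉rankAtLeast lower∉rankAtLeast
                                                  (lower-neighbour w≢j w≢v))))
                   (d[w]≥1 w w≢v w≢j)

  private
    oneOrTwo⇒≤+2 : ∀ {x} → x ≡ + 1 ⊎ x ≡ + 2 → x ℤ.≤ + 2
    oneOrTwo⇒≤+2 (inj₁ refl) = ℤ.+≤+ (s≤s z≤n)
    oneOrTwo⇒≤+2 (inj₂ refl) = ℤP.≤-refl

    oneOrTwo⇒+1≤x : ∀ {x} → x ≡ + 1 ⊎ x ≡ + 2 → + 1 ℤ.≤ x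
    oneOrTwo⇒+1≤x (inj₁ refl) = ℤP.≤-refl
    oneOrTwo⇒+1≤x (inj₂ refl) = ℤ.+≤+ (s≤s z≤n)

    oneOrTwo⇒+0≤x-1 : ∀ {x} → x ≡ + 1 ⊎ x ≡ + 2 → + 0 ℤ.≤ x ℤ.- + 1
    oneOrTwo⇒+0≤x-1 (inj₁ refl) = ℤ.+≤+ z≤n
    oneOrTwo⇒+0≤x-1 (inj₂ refl) = ℤ.+≤+ z≤n

    oneOrTwo⇒≡+2 : ∀ {x} → x ≡ + 1 ⊎ x ≡ + 2 → + 2 ℤ.≤ x → x ≡ + 2
    oneOrTwo⇒≡+2 (inj₁ refl) (ℤ.+≤+ (s≤s ()))
    oneOrTwo⇒≡+2 (inj₂ refl) _ = refl

  oneOrTwo∧uniqueOne⇒stronglyRecurrent : ∀ {c} → (∀ w → lookup c w ≡ + 1 ⊎ lookup c w ≡ + 2) →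
    (∀ {i j} → lookup c i ≡ + 1 → lookup c j ≡ + 1 → i ≡ j) → StronglyRecurrent G c
  oneOrTwo∧uniqueOne⇒stronglyRecurrent {c} oneOrTwo uniqueOne =
    recurrent-c , λ v inVM → recurrent-cMinus v (oneOrTwo⇒≡+2 (oneOrTwo v) (inVM-wheel⁻ {c} {v} inVM))
    where
    other-twos : ∀ v → lookup c v ≡ + 2 → ∃ λ j → j ≢ v × (∀ w → w ≢ j → lookup c w ≡ + 2)
    other-twos v c[v]≡2 with FP.any? (λ w → lookup c w ℤP.≟ + 1)
    ... | yes (j , c[j]≡1) =
      j , j≢v , λ w w≢j → [ (λ c[w]≡1 → ⊥-elim (w≢j (uniqueOne c[w]≡1 c[j]≡1))) , (λ e → e) ]′ (oneOrTwo w)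
      where
      j≢v : j ≢ v
      j≢v refl = +1≢+2 (trans (sym c[j]≡1) c[v]≡2)
    ... | no no-one =
      nxt v , nxt≢ v , λ w _ → [ (λ c[w]≡1 → ⊥-elim (no-one (w , c[w]≡1))) , (λ e → e) ]′ (oneOrTwo w)

    two₀ : ∃ λ v → lookup c v ≡ + 2
    two₀ with oneOrTwo F.zero | oneOrTwo (F.suc F.zero)
    ... | inj₂ c[0]≡2 | _           = F.zero , c[0]≡2
    ... | inj₁ _      | inj₂ c[1]≡2 = F.suc F.zero , c[1]≡2
    ... | inj₁ c[0]≡1 | inj₁ c[1]≡1 with uniqueOne c[0]≡1 c[1]≡1
    ...   | ()

    recurrent-c : Recurrent G c
    recurrent-c with two₀
    ... | v , c[v]≡2 with other-twos v c[v]≡2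
    ...   | j , j≢v , _ =
      recurrent-wheel-criterion v j j≢v (stable-wheel⁺ {c} (oneOrTwo⇒≤+2 ∘ oneOrTwo))
        (ℤP.≤-reflexive (sym c[v]≡2))
        (ℤP.≤-trans (ℤ.+≤+ z≤n) (oneOrTwo⇒+1≤x (oneOrTwo j))) (λ w _ _ → oneOrTwo⇒+1≤x (oneOrTwo w))

    recurrent-cMinus : ∀ v → lookup c v ≡ + 2 → Recurrent G (cMinus G c v)
    recurrent-cMinus v c[v]≡2 with other-twos v c[v]≡2
    ... | j , j≢v , two =
      recurrent-wheel-criterion v j j≢v
        (stable-wheel⁺ {c⁻} (λ w → ℤP.≤-trans (c⁻≤c w (w F.≟ v)) (oneOrTwo⇒≤+2 (oneOrTwo w))))
        (ℤP.≤-reflexive (sym (trans (cMinus-self G c v) c[v]≡2)))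
        (subst (+ 0 ℤ.≤_) (sym (cMinus-other G c j≢v)) (oneOrTwo⇒+0≤x-1 (oneOrTwo j)))
        (λ w w≢v w≢j → ℤP.≤-reflexive (sym (trans (cMinus-other G c w≢v) (cong (ℤ._- + 1) (two w w≢j)))))
      where
      c⁻ = cMinus G c v
      c⁻≤c : ∀ w → Dec (w ≡ v) → lookup c⁻ w ℤ.≤ lookup c w
      c⁻≤c w (yes refl) = ℤP.≤-reflexive (cMinus-self G c w)
      c⁻≤c w (no w≢v)   = subst (ℤ._≤ lookup c w) (sym (cMinus-other G c w≢v)) (ℤP.i-j≤i (lookup c w) (+ 1))

  -- Prime parking functions

  AlmostAllOnes : Vec ℕ (3 + m) → Set
  AlmostAllOnes p = ∃ λ t → lookup p t ≤ 2 × (∀ w → w ≢ t → lookup p w ≡ 1)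

  -- A is the run of ones that starts right after a vertex t with p t ≢ 1.
  decomposable-unless-almostAllOnes : ∀ {p} → ParkingFunction G p → ∀ {z} → lookup p z ≢ 1 →
    ¬ AlmostAllOnes p → ∃ (DecomposableWrt G p)
  decomposable-unless-almostAllOnes {p} pf {z} p[z]≢1 ¬almost = A , decomposition
    where
    one : ∃ λ o → lookup p o ≡ 1
    one = let (o , p[o]≤1) = parkingFunction-∃≤multS G {p} pf z in
          o , ≤-antisym p[o]≤1 (parkingFunction-positive G {p} pf o)

    IsOne? : ∀ w → Dec (lookup p w ≡ 1)
    IsOne? w = lookup p w ℕ.≟ 1

    boundary : ∃ λ t → lookup p t ≢ 1 × ¬ lookup p (nxt t) ≢ 1
    boundary = cycle-exit (λ w → ¬? (IsOne? w)) p[z]≢1 (λ p[o]≢1 → p[o]≢1 (proj₂ one))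

    t = proj₁ boundary
    p[t]≢1 = proj₁ (proj₂ boundary)

    open Unrolling (unrollAt (nxt t))

    pos-t : pos t ≡ 2 + m
    pos-t = trans (cong pos (sym (prv-nxt t))) pos-prv-base

    OnesUpTo : Fin (3 + m) → Set
    OnesUpTo w = ∀ u → pos u ≤ pos w → lookup p u ≡ 1

    A : Subset (3 + m)
    A = subsetOf (λ w → FP.all? (λ u → (pos u ℕ.≤? pos w) →-dec IsOne? u))

    ∈A⁺ : ∀ {w} → OnesUpTo w → w ∈ A
    ∈A⁺ = ∈-subsetOf⁺ (λ w → FP.all? (λ u → (pos u ℕ.≤? pos w) →-dec IsOne? u))

    ∈A⁻ : ∀ {w} → w ∈ A → OnesUpTo w
    ∈A⁻ = ∈-subsetOf⁻ (λ w → FP.all? (λ u → (pos u ℕ.≤? pos w) →-dec IsOne? u))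

    ones : ∀ {w} → w ∈ A → lookup p w ≡ 1
    ones {w} w∈A = ∈A⁻ w∈A w ≤-refl

    nxt-t∈A : nxt t ∈ A
    nxt-t∈A = ∈A⁺ λ u u≤ → subst (λ x → lookup p x ≡ 1) (sym (pos≤base⇒≡base u≤))
                                 (decidable-stable (IsOne? (nxt t)) (proj₂ (proj₂ boundary)))

    t∉A : t ∉ A
    t∉A = p[t]≢1 ∘ ones

    prv∈A⇒∈A : ∀ {b} → prv b ∈ A → lookup p b ≡ 1 → b ∈ A
    prv∈A⇒∈A {b} prv∈A p[b]≡1 = ∈A⁺ λ u u≤b → case m≤n⇒m<n∨m≡n u≤b of λ where
      (inj₂ u≡b) → subst (λ x → lookup p x ≡ 1) (sym (pos-injective u≡b)) p[b]≡1
      (inj₁ u<b) →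
        ∈A⁻ prv∈A u (ℕ.s≤s⁻¹ (subst (suc (pos u) ≤_) (sym (pos-prv b (≤-<-trans z≤n u<b))) u<b))

    nxt∈A⇒≡t : ∀ {b} → nxt b ∈ A → b ∉ A → b ≡ t
    nxt∈A⇒≡t {b} nxt∈A b∉A = decidable-stable (b F.≟ t) λ b≢t →
      b∉A (∈A⁺ λ u u≤b → ∈A⁻ nxt∈A u (≤-trans u≤b (subst (pos b ≤_) (sym (pos-nxt-b b≢t)) (n≤1+n _))))
      where
      pos-nxt-b : b ≢ t → pos (nxt b) ≡ suc (pos b)
      pos-nxt-b b≢t = pos-nxt b (≤∧≢⇒< (pos≤n b) (λ b≡n → b≢t (pos-injective (trans b≡n (sym pos-t)))))

    almostAllOnes : prv t ∈ A → lookup p t ≤ 2 → AlmostAllOnes p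
    almostAllOnes prv∈A p[t]≤2 =
      t , p[t]≤2 , λ w w≢t → ∈A⁻ prv∈A w (ℕ.s≤s⁻¹ (subst (suc (pos w) ≤_) (sym pos-prv-t) (w<t w≢t)))
      where
      pos-prv-t : suc (pos (prv t)) ≡ pos t
      pos-prv-t = pos-prv t (subst (0 <_) (sym pos-t) 0<1+n)
      w<t : ∀ {w} → w ≢ t → pos w < pos t
      w<t {w} w≢t =
        subst (pos w <_) (sym pos-t) (≤∧≢⇒< (pos≤n w) (λ w≡n → w≢t (pos-injective (trans w≡n (sym pos-t)))))

    cut : ∀ {b} → b ∉ A → degIn G A b < lookup p b
    cut {b} b∉A = cut-at (lookup p b) refl
      where
      cut-at : ∀ k → lookup p b ≡ k → degIn G A b < k
      cut-at 0 p[b]≡0 = ⊥-elim (1+n≰n (subst (1 ≤_) p[b]≡0 (parkingFunction-positive G {p} pf b)))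
      cut-at 1 p[b]≡1 = subst (_< 1) (sym (degIn-wheel≡0 nxt∉A prv∉A)) (s≤s z≤n)
        where
        nxt∉A : nxt b ∉ A
        nxt∉A nxt∈A = p[t]≢1 (subst (λ x → lookup p x ≡ 1) (nxt∈A⇒≡t nxt∈A b∉A) p[b]≡1)
        prv∉A : prv b ∉ A
        prv∉A prv∈A = b∉A (prv∈A⇒∈A prv∈A p[b]≡1)
      cut-at 2 p[b]≡2 = s≤s (degIn-wheel≤1 (one-neighbour∉A (prv b SubP.∈? A)))
        where
        almostAllOnes-at : b ≡ t → prv b ∈ A → AlmostAllOnes p
        almostAllOnes-at refl prv∈A = almostAllOnes prv∈A (≤-reflexive p[b]≡2)
        one-neighbour∉A : Dec (prv b ∈ A) → nxt b ∉ A ⊎ prv b ∉ A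
        one-neighbour∉A (no  prv∉A) = inj₂ prv∉A
        one-neighbour∉A (yes prv∈A) = inj₁ λ nxt∈A → ¬almost (almostAllOnes-at (nxt∈A⇒≡t nxt∈A b∉A) prv∈A)
      cut-at (suc (suc (suc _))) _ = s≤s (≤-trans (degIn-wheel≤2 A b) (s≤s (s≤s z≤n)))

    decomposition : DecomposableWrt G p A
    decomposition =
      ones⇒decomposableWrt G {p} {A} (λ _ → ≤-refl) pf (nxt t , nxt-t∈A) (t , SubP.x∉p⇒x∈∁p t∉A) ones cut

  module _ {p : Vec ℕ (3 + m)} (oneOrTwo : ∀ w → lookup p w ≡ 1 ⊎ lookup p w ≡ 2)
           (uniqueTwo : ∀ {i j} → lookup p i ≡ 2 → lookup p j ≡ 2 → i ≡ j) where

    oneOrTwo∧uniqueTwo⇒parkingFunction : ParkingFunction G p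
    oneOrTwo∧uniqueTwo⇒parkingFunction = positive , parks
      where
      positive : ∀ v → v ∈ Sub.⊤ → + 1 ℤ.≤ + lookup p v
      positive v _ = ℤ.+≤+ ([ ≤-reflexive ∘ sym , (λ p[v]≡2 → subst (1 ≤_) (sym p[v]≡2) (s≤s z≤n)) ]′ (oneOrTwo v))
      ParksIn : Subset (3 + m) → Set
      ParksIn S = ∃ λ v → v ∈ S × + lookup p v ℤ.≤ + degInS G (Sub.⊤ ─ S) v
      parks-at : ∀ S {x} → x ∈ S → lookup p x ≡ 1 → ParksIn S
      parks-at S {x} x∈S p[x]≡1 = x , x∈S , ℤ.+≤+ (subst (_≤ suc _) (sym p[x]≡1) (s≤s z≤n))
      parks : ∀ S → S ⊆ Sub.⊤ → Nonempty S → ParksIn S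
      parks S _ (x , x∈S) = [ parks-at S x∈S , (λ p[x]≡2 → parks-two p[x]≡2 (prv x SubP.∈? S)) ]′ (oneOrTwo x)
        where
        parks-two : lookup p x ≡ 2 → Dec (prv x ∈ S) → ParksIn S
        parks-two p[x]≡2 (no prv∉S) =
          x , x∈S , ℤ.+≤+ (subst (_≤ suc _) (sym p[x]≡2)
                                 (s≤s (1≤degIn-wheel (inj₂ (SubP.x∈p∧x∉q⇒x∈p─q SubP.∈⊤ prv∉S)))))
        parks-two p[x]≡2 (yes prv∈S) =
          [ parks-at S prv∈S
          , (λ p[prv]≡2 → ⊥-elim (nxt≢ x (trans (cong nxt (sym (uniqueTwo p[prv]≡2 p[x]≡2))) (nxt-prv x)))) ]′
          (oneOrTwo (prv x))

    -- A vertex outside A next to A must carry the unique 2, so the cycle enters and leaves A at the same vertex.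
    oneOrTwo∧uniqueTwo⇒indecomposable : ¬ ∃ (DecomposableWrt G p)
    oneOrTwo∧uniqueTwo⇒indecomposable (A , decomposition@((a , a∈A) , (b , b∈∁A) , _)) =
      <-irrefl (sym p[u]≡2) (subst (_< lookup p u) (degIn-wheel≡2 nxt-u∈A prv-u∈A) (cut u∉A))
      where
      cut = decomposable⇒degIn<value G {p} {A} decomposition
      b∉A = SubP.x∈∁p⇒x∉p b∈∁A

      two-at : ∀ {u} → u ∉ A → nxt u ∈ A ⊎ prv u ∈ A → lookup p u ≡ 2
      two-at {u} u∉A neighbour∈A =
        [ (λ p[u]≡1 → ⊥-elim (<⇒≱ (cut u∉A) (≤-trans (≤-reflexive p[u]≡1) (1≤degIn-wheel neighbour∈A))))
        , (λ e → e) ]′ (oneOrTwo u)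

      leaving : ∃ λ w → w ∈ A × nxt w ∉ A
      leaving = cycle-exit (SubP._∈? A) a∈A b∉A

      entering : ∃ λ u → u ∉ A × ¬ nxt u ∉ A
      entering = cycle-exit (λ w → ¬? (w SubP.∈? A)) b∉A (λ a∉A → a∉A a∈A)

      u = proj₁ entering
      u∉A = proj₁ (proj₂ entering)

      nxt-u∈A : nxt u ∈ A
      nxt-u∈A = decidable-stable (nxt u SubP.∈? A) (proj₂ (proj₂ entering))

      p[u]≡2 : lookup p u ≡ 2
      p[u]≡2 = two-at u∉A (inj₁ nxt-u∈A)

      u≡nxt-w : u ≡ nxt (proj₁ leaving)
      u≡nxt-w = let (w , w∈A , nxt-w∉A) = leaving in
        uniqueTwo p[u]≡2 (two-at nxt-w∉A (inj₂ (subst (_∈ A) (sym (prv-nxt w)) w∈A)))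

      prv-u∈A : prv u ∈ A
      prv-u∈A = subst (_∈ A) (sym (trans (cong prv u≡nxt-w) (prv-nxt (proj₁ leaving)))) (proj₁ (proj₂ leaving))

  stronglyRecurrent-wheel⇔ : ∀ c →
    StronglyRecurrent G c ⇔ (All (λ x → x ≡ + 1 ⊎ x ≡ + 2) c × count (ℤP._≟ + 1) c ≤ 1)
  stronglyRecurrent-wheel⇔ c = mk⇔
    (λ sr → VecAllP.lookup⁻ (stronglyRecurrent⇒oneOrTwo sr) ,
            unique⇒count≤1 ℤP._≟_ (+ 1) c (stronglyRecurrent⇒uniqueOne sr))
    (λ (oneOrTwo , count≤1) → oneOrTwo∧uniqueOne⇒stronglyRecurrent (VecAllP.lookup⁺ oneOrTwo)
                                (count≤1⇒unique ℤP._≟_ (+ 1) c count≤1))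

  primeParkingFunction⇒oneOrTwo : ∀ {p} → PrimeParkingFunction G p → ∀ w → lookup p w ≡ 1 ⊎ lookup p w ≡ 2
  primeParkingFunction⇒oneOrTwo {p} (pf , prime) w = by-value (lookup p w) refl
    where
    by-value : ∀ k → lookup p w ≡ k → lookup p w ≡ 1 ⊎ lookup p w ≡ 2
    by-value 0 p[w]≡0 = ⊥-elim (1+n≰n (subst (1 ≤_) p[w]≡0 (parkingFunction-positive G {p} pf w)))
    by-value 1 p[w]≡1 = inj₁ p[w]≡1
    by-value 2 p[w]≡2 = inj₂ p[w]≡2
    by-value (suc (suc (suc k))) p[w]≡3+k =
      ⊥-elim (prime (decomposable-unless-almostAllOnes {p} pf {w} p[w]≢1 ¬almost))
      where
      p[w]≢1 : lookup p w ≢ 1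
      p[w]≢1 p[w]≡1 = 0≢1+n (suc-injective (trans (sym p[w]≡1) p[w]≡3+k))
      3+k≰2 : ¬ (3 + k ≤ 2)
      3+k≰2 (s≤s (s≤s ()))
      ¬almost : ¬ AlmostAllOnes p
      ¬almost (t , p[t]≤2 , ones) = case w F.≟ t of λ where
        (yes refl) → 3+k≰2 (subst (_≤ 2) p[w]≡3+k p[t]≤2)
        (no  w≢t)  → 0≢1+n (suc-injective (trans (sym (ones w w≢t)) p[w]≡3+k))

  primeParkingFunction⇒uniqueTwo : ∀ {p} → PrimeParkingFunction G p →
    ∀ {i j} → lookup p i ≡ 2 → lookup p j ≡ 2 → i ≡ j
  primeParkingFunction⇒uniqueTwo {p} (pf , prime) {i} {j} p[i]≡2 p[j]≡2 = decidable-stable (i F.≟ j) λ i≢j →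
    prime (decomposable-unless-almostAllOnes {p} pf {i} (λ p[i]≡1 → 1+n≢n (trans (sym p[i]≡2) p[i]≡1))
                                             (¬almost i≢j))
    where
    ¬almost : i ≢ j → ¬ AlmostAllOnes p
    ¬almost i≢j (t , _ , ones) = case i F.≟ t of λ where
      (yes refl) → 1+n≢n (trans (sym p[j]≡2) (ones j (i≢j ∘ sym)))
      (no  i≢t)  → 1+n≢n (trans (sym p[i]≡2) (ones i i≢t))

  primeParkingFunction-wheel⇔ : ∀ p →
    PrimeParkingFunction G p ⇔ (All (λ x → x ≡ 2 ⊎ x ≡ 1) p × count (ℕ._≟ 2) p ≤ 1)
  primeParkingFunction-wheel⇔ p = mk⇔
    (λ ppf → VecAllP.lookup⁻ (Sum.swap ∘ primeParkingFunction⇒oneOrTwo {p} ppf) ,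
             unique⇒count≤1 ℕ._≟_ 2 p (primeParkingFunction⇒uniqueTwo {p} ppf))
    (λ (twoOrOne , count≤1) → let oneOrTwo  = Sum.swap ∘ VecAllP.lookup⁺ twoOrOne
                                  uniqueTwo = count≤1⇒unique ℕ._≟_ 2 p count≤1 in
      oneOrTwo∧uniqueTwo⇒parkingFunction {p} oneOrTwo uniqueTwo ,
      oneOrTwo∧uniqueTwo⇒indecomposable {p} oneOrTwo uniqueTwo)

proposition3p3 : (n : ℕ) → 3 ≤ n →
    ((c : Vec ℤ n) →
      StronglyRecurrent (Wheel n) c ⇔
        (All (λ x → x ≡ + 1 ⊎ x ≡ + 2) c × count (ℤP._≟ + 1) c ≤ 1))
    × HasCardinality (StronglyRecurrent (Wheel n)) (suc n)
    × HasCardinality (PrimeParkingFunction (Wheel n)) (suc n)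
proposition3p3 (suc (suc (suc m))) (s≤s (s≤s (s≤s _))) =
  stronglyRecurrent-wheel⇔ ,
  hasCardinality-⇔ stronglyRecurrent-wheel⇔ (AtMostOne.hasCardinality-AtMostOne ℤP._≟_ (+ 1) (+ 2) (λ ()) (3 + m)) ,
  hasCardinality-⇔ primeParkingFunction-wheel⇔ (AtMostOne.hasCardinality-AtMostOne ℕ._≟_ 2 1 (λ ()) (3 + m))
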